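{- Let $(\Sigma,\Gamma,\mathcal U)$ be an extended many-sorted finite model finding problem, and for each sort $\theta$ let $X_\theta$ be a value-interchangeable set for $\theta$. If $\sigma$ is a domain permutation such that $\sigma_\theta(v)=v$ for every sort $\theta$ and every $v\in\mathcal U(\theta)\setminus X_\theta$, then $\sigma$ is a domain symmetry.
   Context: A signature $\Sigma$ consists of a finite set of sorts, function symbols $g:A_1\times\dots\times A_n\to B$ and predicate symbols $R:A_1\times\dots\times A_n\to\mathrm{Bool}$. A domain assignment $\mathcal U$ maps each sort to a nonempty finite set. An extended MSFMF problem $(\Sigma,\Gamma,\mathcal U)$ has $\Gamma$ a finite set of many-sorted first-order formulas with equality over $\Sigma$ in which every domain value $v\in\mathcal U(\theta)$ may be used as a term of sort $\theta$ (evaluating to itself). Interpretations $I$ assign functions $\mathcal U(A_1)\times\dots\times\mathcal U(A_n)\to\mathcal U(B)$ to function symbols and relations to predicate symbols. A domain permutation $\sigma$ is a family of permutations $\sigma_\theta$ of $\mathcal U(\theta)$, one per sort; it acts by $(\sigma\bullet I)(g)(\sigma_{A_1}(a_1),\dots,\sigma_{A_n}(a_n))=\sigma_B(I(g)(a_1,\dots,a_n))$ and $(a_1,\dots,a_n)\in I(R)\iff(\sigma_{A_1}(a_1),\dots,\sigma_{A_n}(a_n))\in(\sigma\bullet I)(R)$. A domain symmetry is a domain permutation $\sigma$ such that for every interpretation $I$, $\sigma\bullet I\models\Gamma$ iff $I\models\Gamma$. A set $X\subseteq\mathcal U(\theta)$ is value-interchangeable for $\theta$ if every domain permutation $\sigma$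 with $\sigma_\theta(v)=v$ for all $v\in\mathcal U(\theta)\setminus X$ and $\sigma_{\theta'}$ the identity for all $\theta'\neq\theta$ is a domain symmetry. -}

module Defs where

open import Data.Nat using (ℕ; _<_)
open import Data.Fin using (Fin)
open import Data.Fin.Subset using (Subset; _∉_)
open import Data.Fin.Permutation using (Permutation′; _⟨$⟩ʳ_; _⟨$⟩ˡ_)
open import Data.List using (List; []; _∷_)
open import Data.List.Membership.Propositional using (_∈_)
open import Data.List.Relation.Unary.All as All using (All; []; _∷_)
open import Data.Bool using (Bool; T)
open import Data.Product using (Σ; _×_)
open import Data.Sum using (_⊎_)
open import Data.Unit using (⊤)
open import Data.Empty using (⊥)
open import Relation.Nullary using (¬_)
open import Relation.Binary.PropositionalEquality using (_≡_; _≢_)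
open import Function.Bundles using (_⇔_)

record Signature : Set where
  field
    nSorts   : ℕ
    nFun     : ℕ
    nPred    : ℕ
    funArgs  : Fin nFun → List (Fin nSorts)
    funRes   : Fin nFun → Fin nSorts
    predArgs : Fin nPred → List (Fin nSorts)

  Sort : Set
  Sort = Fin nSorts

record DomainAssignment (S : Signature) : Set where
  open Signature S
  field
    size     : Sort → ℕ
    nonempty : (θ : Sort) → 0 < size θ

module _ (S : Signature) (U : DomainAssignment S) where
  open Signature S
  open DomainAssignment U

  Dom : Sort → Set
  Dom θ = Fin (size θ)

  Tuple : List Sort → Set
  Tuple = All Dom

  mutual
    data Term (ctx : List Sort) : Sort → Set where
      var : {θ : Sort} → θ ∈ ctx → Term ctx θ
      val : {θ : Sort} → Dom θ → Term ctx θ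
      app : (g : Fin nFun) → Terms ctx (funArgs g) → Term ctx (funRes g)

    data Terms (ctx : List Sort) : List Sort → Set where
      []  : Terms ctx []
      _∷_ : {θ : Sort} {θs : List Sort} → Term ctx θ → Terms ctx θs → Terms ctx (θ ∷ θs)

  data Formula (ctx : List Sort) : Set where
    pred  : (R : Fin nPred) → Terms ctx (predArgs R) → Formula ctx
    eq    : {θ : Sort} → Term ctx θ → Term ctx θ → Formula ctx
    true  : Formula ctx
    false : Formula ctx
    not   : Formula ctx → Formula ctx
    and   : Formula ctx → Formula ctx → Formula ctx
    or    : Formula ctx → Formula ctx → Formula ctx
    imp   : Formula ctx → Formula ctx → Formula ctx
    all   : (θ : Sort) → Formula (θ ∷ ctx) → Formula ctx
    ex    : (θ : Sort) → Formula (θ ∷ ctx) → Formula ctx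

  Sentence : Set
  Sentence = Formula []

  record Interpretation : Set where
    field
      fun : (g : Fin nFun) → Tuple (funArgs g) → Dom (funRes g)
      rel : (R : Fin nPred) → Tuple (predArgs R) → Bool

  open Interpretation

  module _ (I : Interpretation) where
    mutual
      evalTerm : {ctx : List Sort} {θ : Sort} → Tuple ctx → Term ctx θ → Dom θ
      evalTerm ρ (var x)    = All.lookup ρ x
      evalTerm ρ (val v)    = v
      evalTerm ρ (app g ts) = fun I g (evalTerms ρ ts)

      evalTerms : {ctx θs : List Sort} → Tuple ctx → Terms ctx θs → Tuple θs
      evalTerms ρ []       = []
      evalTerms ρ (t ∷ ts) = evalTerm ρ t ∷ evalTerms ρ ts

    Sat : {ctx : List Sort} → Tuple ctx → Formula ctx → Set
    Sat ρ (pred R ts) = T (rel I R (evalTerms ρ ts))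
    Sat ρ (eq t u)    = evalTerm ρ t ≡ evalTerm ρ u
    Sat ρ true        = ⊤
    Sat ρ false       = ⊥
    Sat ρ (not φ)     = ¬ Sat ρ φ
    Sat ρ (and φ ψ)   = Sat ρ φ × Sat ρ ψ
    Sat ρ (or φ ψ)    = Sat ρ φ ⊎ Sat ρ ψ
    Sat ρ (imp φ ψ)   = Sat ρ φ → Sat ρ ψ
    Sat ρ (all θ φ)   = (a : Dom θ) → Sat (a ∷ ρ) φ
    Sat ρ (ex θ φ)    = Σ (Dom θ) (λ a → Sat (a ∷ ρ) φ)

    Models : List Sentence → Set
    Models Γ = All (Sat []) Γ

  DomainPermutation : Set
  DomainPermutation = (θ : Sort) → Permutation′ (size θ)

  applyTuple : DomainPermutation → {θs : List Sort} → Tuple θs → Tuple θs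
  applyTuple σ = All.map (λ {θ} a → σ θ ⟨$⟩ʳ a)

  applyTupleInv : DomainPermutation → {θs : List Sort} → Tuple θs → Tuple θs
  applyTupleInv σ = All.map (λ {θ} a → σ θ ⟨$⟩ˡ a)

  -- σ • I, defined by (σ•I)(g)(σ a⃗) = σ_B (I(g)(a⃗)) and
  -- a⃗ ∈ I(R) ⇔ σ a⃗ ∈ (σ•I)(R), i.e. evaluated at b⃗ = σ a⃗ via a⃗ = σ⁻¹ b⃗.
  act : DomainPermutation → Interpretation → Interpretation
  fun (act σ I) g b = σ (funRes g) ⟨$⟩ʳ fun I g (applyTupleInv σ b)
  rel (act σ I) R b = rel I R (applyTupleInv σ b)

  IsDomainSymmetry : List Sentence → DomainPermutation → Set
  IsDomainSymmetry Γ σ = (I : Interpretation) → Models (act σ I) Γ ⇔ Models I Γ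

  IsValueInterchangeable : List Sentence → (θ : Sort) → Subset (size θ) → Set
  IsValueInterchangeable Γ θ X =
    (σ : DomainPermutation) →
    ((v : Dom θ) → v ∉ X → σ θ ⟨$⟩ʳ v ≡ v) →
    ((θ' : Sort) → θ' ≢ θ → (v : Dom θ') → σ θ' ⟨$⟩ʳ v ≡ v) →
    IsDomainSymmetry Γ σ

-- A permutation supported on the sorts θ₁, …, θₙ factors as the composite of
-- its restrictions to the individual sorts θᵢ.  Each restriction moves only
-- values of X_θᵢ inside the single sort θᵢ, so it is a domain symmetry by
-- value interchangeability, and domain symmetries are closed under composition
-- and invariant under pointwise equality of permutations.
module Submission where

open import Defs
open import Data.Bool using (T)
open import Data.Empty using (⊥-elim)
open import Data.Fin using (_≟_)
open import Data.Fin.Permutation using (Permutation′; _⟨$⟩ʳ_; _⟨$⟩ˡ_; _≈_; _∘ₚ_; id; inverseˡ; inverseʳ)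
open import Data.Fin.Subset using (Subset; _∉_)
open import Data.List using (List; []; _∷_; allFin)
open import Data.List.Membership.Propositional using (_∈_)
open import Data.List.Membership.Propositional.Properties using (∈-allFin)
open import Data.List.Relation.Unary.All using ([]; _∷_)
open import Data.List.Relation.Unary.All.Properties using (map-cong; map-id; map-∘)
open import Data.List.Relation.Unary.Any using (here; there)
open import Data.Product using (_,_)
open import Data.Sum using (inj₁; inj₂)
open import Function.Bundles using (_⇔_; mk⇔; Equivalence)
open import Relation.Nullary using (¬_; yes; no)
open import Relation.Binary.PropositionalEquality
  using (_≡_; _≢_; refl; sym; trans; cong; cong₂; subst; module ≡-Reasoning)

inverse-cong : ∀ {n} {π ρ : Permutation′ n} → π ≈ ρ → ∀ w → π ⟨$⟩ˡ w ≡ ρ ⟨$⟩ˡ w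
inverse-cong {π = π} {ρ} π≈ρ w = begin
  π ⟨$⟩ˡ w                    ≡⟨ cong (π ⟨$⟩ˡ_) (sym (inverseʳ ρ)) ⟩
  π ⟨$⟩ˡ (ρ ⟨$⟩ʳ (ρ ⟨$⟩ˡ w))  ≡⟨ cong (π ⟨$⟩ˡ_) (sym (π≈ρ (ρ ⟨$⟩ˡ w))) ⟩
  π ⟨$⟩ˡ (π ⟨$⟩ʳ (ρ ⟨$⟩ˡ w))  ≡⟨ inverseˡ π ⟩
  ρ ⟨$⟩ˡ w                    ∎
  where open ≡-Reasoning

module _ {S : Signature} {U : DomainAssignment S} where
  open Signature S
  open DomainAssignment U
  open Interpretation

  record _≗ᴵ_ (I J : Interpretation S U) : Set where
    field
      fun-≗ : ∀ g b → fun I g b ≡ fun J g b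
      rel-≗ : ∀ R b → rel I R b ≡ rel J R b
  open _≗ᴵ_

  ≗ᴵ-sym : ∀ {I J} → I ≗ᴵ J → J ≗ᴵ I
  ≗ᴵ-sym I≗J = record
    { fun-≗ = λ g b → sym (fun-≗ I≗J g b)
    ; rel-≗ = λ R b → sym (rel-≗ I≗J R b)
    }

  module _ {I J : Interpretation S U} (I≗J : I ≗ᴵ J) where
    mutual
      evalTerm-cong : ∀ {ctx θ} (ρ : Tuple S U ctx) (t : Term S U ctx θ) →
                      evalTerm S U I ρ t ≡ evalTerm S U J ρ t
      evalTerm-cong ρ (var x)    = refl
      evalTerm-cong ρ (val v)    = refl
      evalTerm-cong ρ (app g ts) =
        trans (cong (fun I g) (evalTerms-cong ρ ts)) (fun-≗ I≗J g _)

      evalTerms-cong : ∀ {ctx θs} (ρ : Tuple S U ctx) (ts : Terms S U ctx θs) →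
                       evalTerms S U I ρ ts ≡ evalTerms S U J ρ ts
      evalTerms-cong ρ []       = refl
      evalTerms-cong ρ (t ∷ ts) = cong₂ _∷_ (evalTerm-cong ρ t) (evalTerms-cong ρ ts)

  Sat-transport : ∀ {I J} → I ≗ᴵ J → ∀ {ctx} (ρ : Tuple S U ctx) (φ : Formula S U ctx) →
                  Sat S U I ρ φ → Sat S U J ρ φ
  Sat-transport {I} I≗J ρ (pred R ts) h =
    subst T (trans (cong (rel I R) (evalTerms-cong I≗J ρ ts)) (rel-≗ I≗J R _)) h
  Sat-transport I≗J ρ (eq t u) h =
    trans (sym (evalTerm-cong I≗J ρ t)) (trans h (evalTerm-cong I≗J ρ u))
  Sat-transport I≗J ρ true      h        = h
  Sat-transport I≗J ρ (not φ)   h        = λ s → h (Sat-transport (≗ᴵ-sym I≗J) ρ φ s)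
  Sat-transport I≗J ρ (and φ ψ) (s , t)  = Sat-transport I≗J ρ φ s , Sat-transport I≗J ρ ψ t
  Sat-transport I≗J ρ (or φ ψ)  (inj₁ s) = inj₁ (Sat-transport I≗J ρ φ s)
  Sat-transport I≗J ρ (or φ ψ)  (inj₂ t) = inj₂ (Sat-transport I≗J ρ ψ t)
  Sat-transport I≗J ρ (imp φ ψ) h        =
    λ s → Sat-transport I≗J ρ ψ (h (Sat-transport (≗ᴵ-sym I≗J) ρ φ s))
  Sat-transport I≗J ρ (all θ φ) h        = λ a → Sat-transport I≗J (a ∷ ρ) φ (h a)
  Sat-transport I≗J ρ (ex θ φ)  (a , s)  = a , Sat-transport I≗J (a ∷ ρ) φ s

  Models-transport : ∀ {I J} → I ≗ᴵ J → (Γ : List (Sentence S U)) →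
                     Models S U I Γ → Models S U J Γ
  Models-transport I≗J []      []       = []
  Models-transport I≗J (φ ∷ Γ) (s ∷ ss) = Sat-transport I≗J [] φ s ∷ Models-transport I≗J Γ ss

  Models-cong : ∀ {I J} → I ≗ᴵ J → (Γ : List (Sentence S U)) →
                Models S U I Γ ⇔ Models S U J Γ
  Models-cong I≗J Γ = mk⇔ (Models-transport I≗J Γ) (Models-transport (≗ᴵ-sym I≗J) Γ)

  infix 4 _≈ᵈ_
  _≈ᵈ_ : DomainPermutation S U → DomainPermutation S U → Set
  σ ≈ᵈ τ = ∀ θ → σ θ ≈ τ θ

  idᵈ : DomainPermutation S U
  idᵈ θ = id

  infixr 9 _∘ᵈ_
  _∘ᵈ_ : DomainPermutation S U → DomainPermutation S U → DomainPermutation S U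
  (σ ∘ᵈ τ) θ = σ θ ∘ₚ τ θ

  act-cong : ∀ {σ τ} → σ ≈ᵈ τ → ∀ I → act S U σ I ≗ᴵ act S U τ I
  act-cong {σ} {τ} σ≈τ I = record
    { fun-≗ = λ g b → trans (σ≈τ (funRes g) _) (cong (λ a → τ (funRes g) ⟨$⟩ʳ fun I g a) (inverses-agree b))
    ; rel-≗ = λ R b → cong (rel I R) (inverses-agree b)
    }
    where
    inverses-agree : ∀ {θs} (b : Tuple S U θs) → applyTupleInv S U σ b ≡ applyTupleInv S U τ b
    inverses-agree b = map-cong b (λ {θ} → inverse-cong {π = σ θ} {τ θ} (σ≈τ θ))

  act-id : ∀ I → act S U idᵈ I ≗ᴵ I
  act-id I = record
    { fun-≗ = λ g b → cong (fun I g) (map-id b)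
    ; rel-≗ = λ R b → cong (rel I R) (map-id b)
    }

  act-∘ : ∀ σ τ I → act S U (σ ∘ᵈ τ) I ≗ᴵ act S U τ (act S U σ I)
  act-∘ σ τ I = record
    { fun-≗ = λ g b → cong (λ a → τ (funRes g) ⟨$⟩ʳ (σ (funRes g) ⟨$⟩ʳ fun I g a)) (sym (map-∘ b))
    ; rel-≗ = λ R b → cong (rel I R) (sym (map-∘ b))
    }

  module _ {Γ : List (Sentence S U)} where

    IsDomainSymmetry-resp-≈ᵈ : ∀ {σ τ} → σ ≈ᵈ τ → IsDomainSymmetry S U Γ σ → IsDomainSymmetry S U Γ τ
    IsDomainSymmetry-resp-≈ᵈ {σ} {τ} σ≈τ σ-sym I = mk⇔
      (λ m → Equivalence.to (σ-sym I) (Models-transport (≗ᴵ-sym (act-cong {σ} {τ} σ≈τ I)) Γ m))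
      (λ m → Models-transport (act-cong {σ} {τ} σ≈τ I) Γ (Equivalence.from (σ-sym I) m))

    idᵈ-isDomainSymmetry : IsDomainSymmetry S U Γ idᵈ
    idᵈ-isDomainSymmetry I = Models-cong (act-id I) Γ

    ∘ᵈ-isDomainSymmetry : ∀ {σ τ} → IsDomainSymmetry S U Γ σ → IsDomainSymmetry S U Γ τ →
                          IsDomainSymmetry S U Γ (σ ∘ᵈ τ)
    ∘ᵈ-isDomainSymmetry {σ} {τ} σ-sym τ-sym I = mk⇔
      (λ m → Equivalence.to (σ-sym I)
               (Equivalence.to (τ-sym (act S U σ I)) (Models-transport (act-∘ σ τ I) Γ m)))
      (λ m → Models-transport (≗ᴵ-sym (act-∘ σ τ I)) Γ
               (Equivalence.from (τ-sym (act S U σ I)) (Equivalence.from (σ-sym I) m)))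

  onSort : Sort → DomainPermutation S U → DomainPermutation S U
  onSort k σ θ with θ ≟ k
  ... | yes _ = σ θ
  ... | no  _ = id

  offSort : Sort → DomainPermutation S U → DomainPermutation S U
  offSort k σ θ with θ ≟ k
  ... | yes _ = id
  ... | no  _ = σ θ

  offSort-∘-onSort : ∀ k σ → offSort k σ ∘ᵈ onSort k σ ≈ᵈ σ
  offSort-∘-onSort k σ θ v with θ ≟ k
  ... | yes _ = refl
  ... | no  _ = refl

  onSort-fixesOtherSorts : ∀ k σ θ → θ ≢ k → ∀ v → onSort k σ θ ⟨$⟩ʳ v ≡ v
  onSort-fixesOtherSorts k σ θ θ≢k v with θ ≟ k
  ... | yes θ≡k = ⊥-elim (θ≢k θ≡k)
  ... | no  _   = refl

  FixesOutside : ((θ : Sort) → Subset (size θ)) → DomainPermutation S U → Set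
  FixesOutside X σ = ∀ θ v → v ∉ X θ → σ θ ⟨$⟩ʳ v ≡ v

  SupportedOn : List Sort → DomainPermutation S U → Set
  SupportedOn L σ = ∀ θ → ¬ θ ∈ L → σ θ ≈ id

  onSort-fixesOutside : ∀ {X} k σ → FixesOutside X σ → FixesOutside X (onSort k σ)
  onSort-fixesOutside k σ σ-fixes θ v v∉X with θ ≟ k
  ... | yes _ = σ-fixes θ v v∉X
  ... | no  _ = refl

  offSort-fixesOutside : ∀ {X} k σ → FixesOutside X σ → FixesOutside X (offSort k σ)
  offSort-fixesOutside k σ σ-fixes θ v v∉X with θ ≟ k
  ... | yes _ = refl
  ... | no  _ = σ-fixes θ v v∉X

  offSort-supportedOn : ∀ {L} k σ → SupportedOn (k ∷ L) σ → SupportedOn L (offSort k σ)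
  offSort-supportedOn k σ σ-supp θ θ∉L v with θ ≟ k
  ... | yes _   = refl
  ... | no  θ≢k = σ-supp θ (λ { (here θ≡k) → θ≢k θ≡k ; (there θ∈L) → θ∉L θ∈L }) v

  module _ {Γ : List (Sentence S U)} {X : (θ : Sort) → Subset (size θ)}
           (interchangeable : (θ : Sort) → IsValueInterchangeable S U Γ θ (X θ)) where

    onSort-isDomainSymmetry : ∀ k σ → FixesOutside X σ → IsDomainSymmetry S U Γ (onSort k σ)
    onSort-isDomainSymmetry k σ σ-fixes =
      interchangeable k (onSort k σ) (onSort-fixesOutside k σ σ-fixes k) (onSort-fixesOtherSorts k σ)

    supported-isDomainSymmetry : ∀ L σ → FixesOutside X σ → SupportedOn L σ → IsDomainSymmetry S U Γ σ
    supported-isDomainSymmetry [] σ σ-fixes σ-supp =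
      IsDomainSymmetry-resp-≈ᵈ {σ = idᵈ} {τ = σ} (λ θ v → sym (σ-supp θ (λ ()) v)) idᵈ-isDomainSymmetry
    supported-isDomainSymmetry (k ∷ L) σ σ-fixes σ-supp =
      IsDomainSymmetry-resp-≈ᵈ {σ = offSort k σ ∘ᵈ onSort k σ} {τ = σ} (offSort-∘-onSort k σ)
        (∘ᵈ-isDomainSymmetry {σ = offSort k σ} {τ = onSort k σ}
          (supported-isDomainSymmetry L (offSort k σ)
            (offSort-fixesOutside k σ σ-fixes) (offSort-supportedOn k σ σ-supp))
          (onSort-isDomainSymmetry k σ σ-fixes))

mainTheorem15 : (S : Signature) (U : DomainAssignment S) (Γ : List (Sentence S U))
    (X : (θ : Signature.Sort S) → Subset (DomainAssignment.size U θ)) →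
    ((θ : Signature.Sort S) → IsValueInterchangeable S U Γ θ (X θ)) →
    (σ : DomainPermutation S U) →
    ((θ : Signature.Sort S) (v : Dom S U θ) → v ∉ X θ → σ θ ⟨$⟩ʳ v ≡ v) →
    IsDomainSymmetry S U Γ σ
mainTheorem15 S U Γ X interchangeable σ σ-fixes =
  supported-isDomainSymmetry interchangeable (allFin _) σ σ-fixes
    (λ θ θ∉allFin → ⊥-elim (θ∉allFin (∈-allFin θ)))
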